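{- Let $p\ge 7$ be a prime, $\zeta=e^{2\pi i/p}$, $\mathbb{K}=\mathbb{Q}(\zeta+\zeta^{ -1})$, $n=\frac{p-1}{2}$, $\mathcal{O}_{\mathbb{K}}=\mathbb{Z}[\zeta+\zeta^{ -1}]$, and $e_j=\zeta^j+\zeta^{ -j}$ for $1\le j\le n$. Let $I\subseteq\mathcal{O}_{\mathbb{K}}$ be the $\mathbb{Z}$-module with $\mathbb{Z}$-basis $\{e_1,e_2,\dots,e_{n-1},\,-e_1-2e_2-\cdots-2e_n\}$. Then $I$ is not an ideal of $\mathcal{O}_{\mathbb{K}}$. -}

module Defs where

open import Data.Nat as ℕ using (ℕ; zero; suc; NonZero; _∸_)
open import Data.Nat.DivMod using (_mod_; _/_)
open import Data.Fin using (Fin; toℕ)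
open import Data.Fin.Properties using () renaming (_≟_ to _≟ᶠ_)
open import Data.Integer using (ℤ; +_; -_) renaming (_+_ to _+ℤ_; _*_ to _*ℤ_)
open import Data.List using (List; []; _∷_)
open import Data.Product using (Σ; ∃; _×_)
open import Relation.Nullary using (yes; no)
open import Relation.Binary.PropositionalEquality using (_≡_)

Σℤ : ℕ → (ℕ → ℤ) → ℤ
Σℤ zero    f = + 0
Σℤ (suc m) f = Σℤ m f +ℤ f m

module Cyclotomic (p : ℕ) .{{_ : NonZero p}} where

  -- Elements of ℤ[x]/(x^p - 1): coefficient vectors of 1, x, …, x^(p-1).
  -- ℤ[ζ] ≅ ℤ[x]/(Φ_p) is the quotient of this by the ideal ℤ·(1+x+…+x^(p-1)),
  -- so equality in ℤ[ζ] is "differ by a constant vector" (see _≈_).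
  Elt : Set
  Elt = Fin p → ℤ

  _≈_ : Elt → Elt → Set
  a ≈ b = ∃ λ (c : ℤ) → ∀ k → a k ≡ b k +ℤ c

  0ᵉ : Elt
  0ᵉ _ = + 0

  _+ᵉ_ : Elt → Elt → Elt
  (a +ᵉ b) k = a k +ℤ b k

  -ᵉ_ : Elt → Elt
  (-ᵉ a) k = - (a k)

  _•_ : ℤ → Elt → Elt
  (c • a) k = c *ℤ a k

  _*ᵉ_ : Elt → Elt → Elt
  (a *ᵉ b) k = Σℤ p (λ i → a (i mod p) *ℤ b ((toℕ k ℕ.+ (p ∸ i)) mod p))

  ζ^ : ℕ → Elt
  ζ^ j k with k ≟ᶠ (j mod p)
  ... | yes _ = + 1
  ... | no  _ = + 0

  const : ℤ → Elt
  const c = c • ζ^ 0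

  e : ℕ → Elt
  e j = ζ^ j +ᵉ ζ^ (p ∸ j)

  evalθ : List ℤ → Elt
  evalθ []       = 0ᵉ
  evalθ (c ∷ cs) = const c +ᵉ (e 1 *ᵉ evalθ cs)

  InOK : Elt → Set
  InOK x = ∃ λ (f : List ℤ) → x ≈ evalθ f

  n : ℕ
  n = (p ∸ 1) / 2

  Σᵉ : ℕ → (ℕ → Elt) → Elt
  Σᵉ m f k = Σℤ m (λ j → f j k)

  g : Elt
  g = (-ᵉ e 1) +ᵉ (-ᵉ Σᵉ (n ∸ 1) (λ j → (+ 2) • e (j ℕ.+ 2)))

  InI : Elt → Set
  InI y = Σ (ℕ → ℤ) λ c → ∃ λ (d : ℤ) →
            y ≈ (Σᵉ (n ∸ 1) (λ j → c j • e (suc j)) +ᵉ (d • g))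

  IsIdealOfOK : (Elt → Set) → Set
  IsIdealOfOK S =
      (∀ x → S x → InOK x)
    × S 0ᵉ
    × (∀ x y → S x → S y → S (x +ᵉ y))
    × (∀ x → S x → S (-ᵉ x))
    × (∀ r x → InOK r → S x → S (r *ᵉ x))

module Submission where

-- Write p = 2n + 1 with n ≥ 3.  We exhibit r ∈ O_K and y ∈ I with
-- r·y ∉ I, namely r = θ = e₁ and y = e_{n-1}, whose product is e_n + e_{n-2}.
-- The obstruction is the linear functional  x ↦ x_n − x_0  on ℤ[ζ], where
-- x_t is the coefficient of ζ^t; it is well defined on ℤ[ζ] because it
-- kills constant vectors.  Every e_j (0 < j < n) vanishes at positions 0 and
-- n, while the last generator g = −e₁ − 2e₂ − ⋯ − 2e_n has g_0 = 0 and
-- g_n = −2; hence the functional takes only even values on I.  On the other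
-- hand (e₁·e_{n-1})_n − (e₁·e_{n-1})_0 = 1 − 0 is odd.

open import Defs
open import Data.Nat using (ℕ; NonZero; _≤_)
open import Data.Nat.Primality using (Prime)
open import Relation.Nullary using (¬_)

open import Data.Nat as ℕ using (zero; suc; _∸_; _<_; z≤n; s≤s; _%_; _/_)
import Data.Nat.Properties as ℕP
open import Data.Nat.DivMod using (_mod_; m%n<n; m<n⇒m%n≡m; [m+n]%n≡m%n; m≡m%n+[m/n]*n; m*n/n≡m)
open import Data.Nat.Divisibility using (m%n≡0⇒n∣m)
open import Data.Nat.Divisibility.Core using (hasNonTrivialDivisor)
open import Data.Fin using (Fin; toℕ; fromℕ<)
open import Data.Fin.Properties using (toℕ<n; toℕ-fromℕ<; toℕ-injective) renaming (_≟_ to _≟ᶠ_)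
open import Data.Integer using (ℤ; +_; -_; -[1+_]; ∣_∣) renaming (_+_ to _+ℤ_; _*_ to _*ℤ_)
import Data.Integer.Properties as ℤP
open import Data.Integer.Tactic.RingSolver using (solve-∀)
open import Algebra.Properties.CommutativeSemigroup ℤP.+-commutativeSemigroup using (interchange)
open import Data.List using ([]; _∷_)
open import Data.Product using (∃; _,_)
open import Data.Empty using (⊥-elim)
open import Relation.Nullary using (yes; no)
open import Relation.Binary.PropositionalEquality

Σℤ-cong : ∀ m {f h : ℕ → ℤ} → (∀ j → j < m → f j ≡ h j) → Σℤ m f ≡ Σℤ m h
Σℤ-cong zero    f≗h = refl
Σℤ-cong (suc m) f≗h =
  cong₂ _+ℤ_ (Σℤ-cong m (λ j j<m → f≗h j (ℕP.m<n⇒m<1+n j<m))) (f≗h m (ℕP.n<1+n m))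

Σℤ-zero : ∀ m {f : ℕ → ℤ} → (∀ j → j < m → f j ≡ + 0) → Σℤ m f ≡ + 0
Σℤ-zero zero    f≗0 = refl
Σℤ-zero (suc m) f≗0 =
  cong₂ _+ℤ_ (Σℤ-zero m (λ j j<m → f≗0 j (ℕP.m<n⇒m<1+n j<m))) (f≗0 m (ℕP.n<1+n m))

Σℤ-single : ∀ m {f : ℕ → ℤ} t → t < m → (∀ j → j < m → j ≢ t → f j ≡ + 0) → Σℤ m f ≡ f t
Σℤ-single (suc m) {f} t t<1+m others with t ℕ.≟ m
... | yes refl = begin
  Σℤ m f +ℤ f t ≡⟨ cong (_+ℤ f t) (Σℤ-zero m (λ j j<m → others j (ℕP.m<n⇒m<1+n j<m) (ℕP.<⇒≢ j<m))) ⟩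
  + 0 +ℤ f t    ≡⟨ ℤP.+-identityˡ (f t) ⟩
  f t           ∎
  where open ≡-Reasoning
... | no t≢m = begin
  Σℤ m f +ℤ f m ≡⟨ cong₂ _+ℤ_ (Σℤ-single m t t<m (λ j j<m → others j (ℕP.m<n⇒m<1+n j<m)))
                               (others m (ℕP.n<1+n m) (≢-sym t≢m)) ⟩
  f t +ℤ + 0    ≡⟨ ℤP.+-identityʳ (f t) ⟩
  f t           ∎
  where
    open ≡-Reasoning
    t<m : t < m
    t<m = ℕP.≤∧≢⇒< (ℕ.s≤s⁻¹ t<1+m) t≢m

Σℤ-+ : ∀ m (f h : ℕ → ℤ) → Σℤ m (λ j → f j +ℤ h j) ≡ Σℤ m f +ℤ Σℤ m h
Σℤ-+ zero    f h = refl
Σℤ-+ (suc m) f h =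
  trans (cong (_+ℤ (f m +ℤ h m)) (Σℤ-+ m f h)) (interchange (Σℤ m f) (Σℤ m h) (f m) (h m))

δ : ℕ → ℕ → ℤ
δ i j with i ℕ.≟ j
... | yes _ = + 1
... | no  _ = + 0

δ-refl : ∀ i → δ i i ≡ + 1
δ-refl i with i ℕ.≟ i
... | yes _   = refl
... | no  i≢i = ⊥-elim (i≢i refl)

δ-≢ : ∀ {i j} → i ≢ j → δ i j ≡ + 0
δ-≢ {i} {j} i≢j with i ℕ.≟ j
... | yes i≡j = ⊥-elim (i≢j i≡j)
... | no  _   = refl

δ-∸ : ∀ {k j} → j ≤ k → δ (k ∸ j) 0 ≡ δ k j
δ-∸ {k} {j} j≤k with k ℕ.≟ j
... | yes refl = trans (cong (λ x → δ x 0) (ℕP.n∸n≡0 k)) (δ-refl 0)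
... | no  k≢j  = δ-≢ k∸j≢0
  where
    k∸j≢0 : k ∸ j ≢ 0
    k∸j≢0 k∸j≡0 = k≢j (ℕP.≤-antisym (ℕP.m∸n≡0⇒m≤n k∸j≡0) j≤k)

δ-mirror : ∀ {p t j} → t ≤ p → j ≤ p → δ t (p ∸ j) ≡ δ (p ∸ t) j
δ-mirror {p} {t} {j} t≤p j≤p with t ℕ.≟ p ∸ j
... | yes refl = sym (trans (cong (λ x → δ x j) (ℕP.m∸[m∸n]≡n j≤p)) (δ-refl j))
... | no  t≢   = sym (δ-≢ (λ p∸t≡j → t≢ (trans (sym (ℕP.m∸[m∸n]≡n t≤p)) (cong (p ∸_) p∸t≡j))))

1≢even : ∀ d → + 1 ≢ d *ℤ -[1+ 1 ]
1≢even d 1≡ = odd ∣ d ∣ (trans (cong ∣_∣ 1≡) (ℤP.abs-* d -[1+ 1 ]))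
  where
    odd : ∀ a → 1 ≢ a ℕ.* 2
    odd zero    ()
    odd (suc a) ()

prime-odd : ∀ {q} → Prime q → 3 ≤ q → q % 2 ≡ 1
prime-odd {q} q-prime 3≤q with q % 2 in q%2≡0 | m%n<n q 2
... | 0           | _ = ⊥-elim (Prime.notComposite q-prime (hasNonTrivialDivisor 3≤q (m%n≡0⇒n∣m q 2 q%2≡0)))
... | 1           | _ = refl
... | suc (suc _) | s≤s (s≤s ())

half-≥3 : ∀ m → 6 ≤ m ℕ.+ m → 3 ≤ m
half-≥3 zero                ()
half-≥3 (suc zero)          (s≤s (s≤s ()))
half-≥3 (suc (suc zero))    (s≤s (s≤s (s≤s (s≤s ()))))
half-≥3 (suc (suc (suc m))) _ = s≤s (s≤s (s≤s z≤n))

-- Coefficient computations in ℤ[x]/(x^p − 1), for an arbitrary modulus p.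
module Coordinates (p : ℕ) .{{_ : NonZero p}} where
  open Cyclotomic p

  toℕ-mod : ∀ a → toℕ (a mod p) ≡ a % p
  toℕ-mod a = toℕ-fromℕ< (m%n<n a p)

  p∸-< : ∀ {j} → 0 < j → j ≤ p → p ∸ j < p
  p∸-< 0<j j≤p = ℕP.∸-monoʳ-< 0<j j≤p

  ζ^-coord : ∀ j k → ζ^ j k ≡ δ (toℕ k) (j % p)
  ζ^-coord j k with k ≟ᶠ (j mod p)
  ... | yes k≡ = sym (trans (cong (δ (toℕ k)) (sym (trans (cong toℕ k≡) (toℕ-mod j)))) (δ-refl (toℕ k)))
  ... | no  k≢ = sym (δ-≢ (λ eq → k≢ (toℕ-injective (trans eq (sym (toℕ-mod j))))))

  e-coord : ∀ {j} → 0 < j → j < p → ∀ k → e j k ≡ δ (toℕ k) j +ℤ δ (toℕ k) (p ∸ j)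
  e-coord 0<j j<p k = cong₂ _+ℤ_
    (trans (ζ^-coord _ k) (cong (δ (toℕ k)) (m<n⇒m%n≡m j<p)))
    (trans (ζ^-coord _ k) (cong (δ (toℕ k)) (m<n⇒m%n≡m (p∸-< 0<j (ℕP.<⇒≤ j<p)))))

  -- The position t − j (mod p); it is the index used by the product _*ᵉ_.
  shift : ℕ → Fin p → Fin p
  shift j k = (toℕ k ℕ.+ (p ∸ j)) mod p

  shift-≥ : ∀ {j} k → j ≤ toℕ k → toℕ (shift j k) ≡ toℕ k ∸ j
  shift-≥ {j} k j≤k = begin
    toℕ (shift j k)          ≡⟨ toℕ-mod _ ⟩
    (toℕ k ℕ.+ (p ∸ j)) % p  ≡⟨ cong (_% p) rearrange ⟩
    ((toℕ k ∸ j) ℕ.+ p) % p  ≡⟨ [m+n]%n≡m%n (toℕ k ∸ j) p ⟩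
    (toℕ k ∸ j) % p          ≡⟨ m<n⇒m%n≡m (ℕP.≤-<-trans (ℕP.m∸n≤m (toℕ k) j) (toℕ<n k)) ⟩
    toℕ k ∸ j                ∎
    where
      open ≡-Reasoning
      rearrange : toℕ k ℕ.+ (p ∸ j) ≡ (toℕ k ∸ j) ℕ.+ p
      rearrange = trans (sym (ℕP.+-∸-assoc (toℕ k) (ℕP.≤-trans j≤k (ℕP.<⇒≤ (toℕ<n k)))))
                        (ℕP.+-∸-comm p j≤k)

  shift-< : ∀ {j} k → toℕ k < j → j ≤ p → toℕ (shift j k) ≡ toℕ k ℕ.+ (p ∸ j)
  shift-< {j} k k<j j≤p = trans (toℕ-mod _) (m<n⇒m%n≡m below-p)
    where
      below-p : toℕ k ℕ.+ (p ∸ j) < p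
      below-p = subst (toℕ k ℕ.+ (p ∸ j) <_) (ℕP.m+[n∸m]≡n j≤p) (ℕP.+-monoˡ-< (p ∸ j) k<j)

  ζ⁰-shift : ∀ {j} → j < p → ∀ k → ζ^ 0 (shift j k) ≡ ζ^ j k
  ζ⁰-shift {j} j<p k = begin
    ζ^ 0 (shift j k)             ≡⟨ ζ^-coord 0 (shift j k) ⟩
    δ (toℕ (shift j k)) (0 % p)  ≡⟨ cong (δ (toℕ (shift j k))) (m<n⇒m%n≡m (ℕP.≤-<-trans z≤n j<p)) ⟩
    δ (toℕ (shift j k)) 0        ≡⟨ by-cases ⟩
    δ (toℕ k) j                  ≡⟨ cong (δ (toℕ k)) (m<n⇒m%n≡m j<p) ⟨
    δ (toℕ k) (j % p)            ≡⟨ ζ^-coord j k ⟨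
    ζ^ j k                       ∎
    where
      open ≡-Reasoning
      by-cases : δ (toℕ (shift j k)) 0 ≡ δ (toℕ k) j
      by-cases with j ℕ.≤? toℕ k
      ... | yes j≤k = trans (cong (λ x → δ x 0) (shift-≥ k j≤k)) (δ-∸ j≤k)
      ... | no  j≰k = trans (δ-≢ (λ eq → ℕP.<⇒≢ 0<p∸j (sym (ℕP.m+n≡0⇒n≡0 (toℕ k) (trans (sym shifted) eq)))))
                            (sym (δ-≢ (ℕP.<⇒≢ k<j)))
        where
          k<j = ℕP.≰⇒> j≰k
          0<p∸j = ℕP.m<n⇒0<n∸m j<p
          shifted = shift-< k k<j (ℕP.<⇒≤ j<p)

  *ᵉ-distribʳ-+ᵉ : ∀ a b c k → ((a +ᵉ b) *ᵉ c) k ≡ (a *ᵉ c) k +ℤ (b *ᵉ c) k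
  *ᵉ-distribʳ-+ᵉ a b c k =
    trans (Σℤ-cong p (λ i _ → ℤP.*-distribʳ-+ _ (a (i mod p)) (b (i mod p))))
          (Σℤ-+ p _ _)

  ζ^-*ᵉ : ∀ {j} → j < p → ∀ b k → (ζ^ j *ᵉ b) k ≡ b (shift j k)
  ζ^-*ᵉ {j} j<p b k = begin
    (ζ^ j *ᵉ b) k                    ≡⟨ Σℤ-single p j j<p others ⟩
    ζ^ j (j mod p) *ℤ b (shift j k)  ≡⟨ cong (_*ℤ b (shift j k)) (trans (reduced j<p) (δ-refl j)) ⟩
    + 1 *ℤ b (shift j k)             ≡⟨ ℤP.*-identityˡ _ ⟩
    b (shift j k)                    ∎
    where
      open ≡-Reasoning
      reduced : ∀ {i} → i < p → ζ^ j (i mod p) ≡ δ i j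
      reduced {i} i<p = trans (ζ^-coord j (i mod p))
        (cong₂ δ (trans (toℕ-mod i) (m<n⇒m%n≡m i<p)) (m<n⇒m%n≡m j<p))
      others : ∀ i → i < p → i ≢ j → ζ^ j (i mod p) *ℤ b (shift i k) ≡ + 0
      others i i<p i≢j = cong (_*ℤ b (shift i k)) (trans (reduced i<p) (δ-≢ i≢j))

  e-*ᵉ : ∀ {j} → 0 < j → j < p → ∀ b k → (e j *ᵉ b) k ≡ b (shift j k) +ℤ b (shift (p ∸ j) k)
  e-*ᵉ 0<j j<p b k = trans (*ᵉ-distribʳ-+ᵉ (ζ^ _) (ζ^ _) b k)
    (cong₂ _+ℤ_ (ζ^-*ᵉ j<p b k) (ζ^-*ᵉ (p∸-< 0<j (ℕP.<⇒≤ j<p)) b k))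

  e-*ᵉ-unit : ∀ {j} → 0 < j → j < p → ∀ b → (∀ m → b m ≡ ζ^ 0 m) → ∀ k → (e j *ᵉ b) k ≡ e j k
  e-*ᵉ-unit 0<j j<p b b≗1 k = trans (e-*ᵉ 0<j j<p b k) (cong₂ _+ℤ_
    (trans (b≗1 _) (ζ⁰-shift j<p k))
    (trans (b≗1 _) (ζ⁰-shift (p∸-< 0<j (ℕP.<⇒≤ j<p)) k)))

  -- θ = e₁ lies in O_K: it is the value at θ of the polynomial X.
  e₁∈OK : 1 < p → InOK (e 1)
  e₁∈OK 1<p = (+ 0 ∷ + 1 ∷ []) , + 0 , λ k → sym (begin
    (const (+ 0) k +ℤ (e 1 *ᵉ one) k) +ℤ + 0  ≡⟨ ℤP.+-identityʳ _ ⟩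
    const (+ 0) k +ℤ (e 1 *ᵉ one) k           ≡⟨ cong (const (+ 0) k +ℤ_) (e-*ᵉ-unit (s≤s z≤n) 1<p one one≗1 k) ⟩
    + 0 +ℤ e 1 k                              ≡⟨ ℤP.+-identityˡ _ ⟩
    e 1 k                                     ∎)
    where
      open ≡-Reasoning
      one : Elt
      one = const (+ 1) +ᵉ (e 1 *ᵉ 0ᵉ)
      one≗1 : ∀ m → one m ≡ ζ^ 0 m
      one≗1 m = trans (cong₂ _+ℤ_ (ℤP.*-identityˡ (ζ^ 0 m)) (e-*ᵉ (s≤s z≤n) 1<p 0ᵉ m))
                      (ℤP.+-identityʳ (ζ^ 0 m))

  e∈I : ∀ {i} → i < n ∸ 1 → InI (e (suc i))
  e∈I {i} i<n∸1 = (λ j → δ j i) , + 0 , + 0 , λ k → sym (begin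
    (span k +ℤ + 0 *ℤ g k) +ℤ + 0  ≡⟨ ℤP.+-identityʳ _ ⟩
    span k +ℤ + 0                  ≡⟨ ℤP.+-identityʳ _ ⟩
    span k                         ≡⟨ Σℤ-single (n ∸ 1) i i<n∸1 (λ j _ j≢i → cong (_*ℤ e (suc j) k) (δ-≢ j≢i)) ⟩
    δ i i *ℤ e (suc i) k           ≡⟨ cong (_*ℤ e (suc i) k) (δ-refl i) ⟩
    + 1 *ℤ e (suc i) k             ≡⟨ ℤP.*-identityˡ _ ⟩
    e (suc i) k                    ∎)
    where
      open ≡-Reasoning
      span : Elt
      span k = Σℤ (n ∸ 1) (λ j → δ j i *ℤ e (suc j) k)

  c₀ : Fin p
  c₀ = fromℕ< (ℕ.>-nonZero⁻¹ p)

  toℕ-c₀ : toℕ c₀ ≡ 0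
  toℕ-c₀ = toℕ-fromℕ< (ℕ.>-nonZero⁻¹ p)

  e-c₀ : ∀ {j} → 0 < j → j < p → e j c₀ ≡ + 0
  e-c₀ {j} 0<j j<p = begin
    e j c₀                               ≡⟨ e-coord 0<j j<p c₀ ⟩
    δ (toℕ c₀) j +ℤ δ (toℕ c₀) (p ∸ j)  ≡⟨ cong (λ t → δ t j +ℤ δ t (p ∸ j)) toℕ-c₀ ⟩
    δ 0 j +ℤ δ 0 (p ∸ j)                ≡⟨ cong₂ _+ℤ_ (δ-≢ (ℕP.<⇒≢ 0<j)) (δ-≢ (ℕP.<⇒≢ (ℕP.m<n⇒0<n∸m j<p))) ⟩
    + 0                                  ∎
    where open ≡-Reasoning

  prime-shape : Prime p → 7 ≤ p → p ≡ suc (n ℕ.+ n)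
  prime-shape p-prime 7≤p = begin
    p                        ≡⟨ p≡1+2h ⟩
    suc ((p / 2) ℕ.* 2)      ≡⟨ cong (λ h → suc (h ℕ.* 2)) h≡n ⟩
    suc (n ℕ.* 2)            ≡⟨ cong suc (trans (ℕP.*-comm n 2) (cong (n ℕ.+_) (ℕP.+-identityʳ n))) ⟩
    suc (n ℕ.+ n)            ∎
    where
      open ≡-Reasoning
      p≡1+2h : p ≡ suc ((p / 2) ℕ.* 2)
      p≡1+2h = trans (m≡m%n+[m/n]*n p 2)
        (cong (ℕ._+ (p / 2) ℕ.* 2) (prime-odd p-prime (ℕP.≤-trans (ℕP.m≤n+m 3 4) 7≤p)))
      h≡n : p / 2 ≡ n
      h≡n = sym (trans (cong (λ x → (x ∸ 1) / 2) p≡1+2h) (m*n/n≡m (p / 2) 2))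

  module OddModulus (p≡ : p ≡ suc (n ℕ.+ n)) (3≤n : 3 ≤ n) where

    1≤n : 1 ≤ n
    1≤n = ℕP.≤-trans (s≤s z≤n) 3≤n

    n<n+n : n < n ℕ.+ n
    n<n+n = ℕP.m<m+n n 1≤n

    n<p : n < p
    n<p = subst (n <_) (sym p≡) (s≤s (ℕP.m≤m+n n n))

    1<p : 1 < p
    1<p = ℕP.≤-<-trans 1≤n n<p

    p∸1≡ : p ∸ 1 ≡ n ℕ.+ n
    p∸1≡ = cong (_∸ 1) p≡

    p∸[n+n]≡1 : p ∸ (n ℕ.+ n) ≡ 1
    p∸[n+n]≡1 = trans (cong (_∸ (n ℕ.+ n)) p≡) (ℕP.m+n∸n≡m 1 (n ℕ.+ n))

    p∸[1+n]≡n : p ∸ suc n ≡ n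
    p∸[1+n]≡n = trans (cong (_∸ suc n) p≡) (ℕP.m+n∸n≡m n n)

    p∸n≡1+n : p ∸ n ≡ suc n
    p∸n≡1+n = trans (cong (_∸ n) p≡) (trans (ℕP.+-∸-assoc 1 (ℕP.m≤m+n n n)) (cong suc (ℕP.m+n∸n≡m n n)))

    cₙ : Fin p
    cₙ = fromℕ< n<p

    toℕ-cₙ : toℕ cₙ ≡ n
    toℕ-cₙ = toℕ-fromℕ< n<p

    e-low : ∀ {j} → 0 < j → j ≤ n → ∀ {k t} → toℕ k ≡ t → t ≤ n → e j k ≡ δ t j
    e-low {j} 0<j j≤n {k} {t} k≡t t≤n = begin
      e j k                             ≡⟨ e-coord 0<j (ℕP.≤-<-trans j≤n n<p) k ⟩
      δ (toℕ k) j +ℤ δ (toℕ k) (p ∸ j)  ≡⟨ cong (λ x → δ x j +ℤ δ x (p ∸ j)) k≡t ⟩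
      δ t j +ℤ δ t (p ∸ j)              ≡⟨ cong (δ t j +ℤ_) (δ-≢ (ℕP.<⇒≢ t<p∸j)) ⟩
      δ t j +ℤ + 0                      ≡⟨ ℤP.+-identityʳ _ ⟩
      δ t j                             ∎
      where
        open ≡-Reasoning
        t<p∸j : t < p ∸ j
        t<p∸j = ℕP.≤-<-trans t≤n (subst (_≤ p ∸ j) p∸n≡1+n (ℕP.∸-monoʳ-≤ p j≤n))

    e-high : ∀ {j} → 0 < j → j ≤ n → ∀ {k t} → toℕ k ≡ t → n < t → e j k ≡ δ (p ∸ t) j
    e-high {j} 0<j j≤n {k} {t} k≡t n<t = begin
      e j k                             ≡⟨ e-coord 0<j j<p k ⟩
      δ (toℕ k) j +ℤ δ (toℕ k) (p ∸ j)  ≡⟨ cong (λ x → δ x j +ℤ δ x (p ∸ j)) k≡t ⟩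
      δ t j +ℤ δ t (p ∸ j)              ≡⟨ cong₂ _+ℤ_ (δ-≢ (ℕP.>⇒≢ (ℕP.≤-<-trans j≤n n<t))) (δ-mirror t≤p (ℕP.<⇒≤ j<p)) ⟩
      + 0 +ℤ δ (p ∸ t) j                ≡⟨ ℤP.+-identityˡ _ ⟩
      δ (p ∸ t) j                       ∎
      where
        open ≡-Reasoning
        j<p : j < p
        j<p = ℕP.≤-<-trans j≤n n<p
        t≤p : t ≤ p
        t≤p = subst (_≤ p) k≡t (ℕP.<⇒≤ (toℕ<n k))

    e-cₙ : ∀ {j} → 0 < j → j ≤ n → e j cₙ ≡ δ n j
    e-cₙ 0<j j≤n = e-low 0<j j≤n toℕ-cₙ ℕP.≤-refl

    two-below : ∀ {j} → j < n ∸ 1 → suc (suc j) ≤ n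
    two-below {j} j<n∸1 = subst (suc (suc j) ≤_) (ℕP.m+[n∸m]≡n 1≤n) (s≤s j<n∸1)

    -- The definition of g indexes its summands as j + 2.
    j+2≡ : ∀ j → j ℕ.+ 2 ≡ suc (suc j)
    j+2≡ j = ℕP.+-comm j 2

    -- e_{n−1} = e_{suc i₀} is the last basis vector of I.
    i₀ : ℕ
    i₀ = n ∸ 2

    2+i₀≡n : suc (suc i₀) ≡ n
    2+i₀≡n = ℕP.m+[n∸m]≡n (ℕP.≤-trans (s≤s (s≤s z≤n)) 3≤n)

    i₀<n∸1 : i₀ < n ∸ 1
    i₀<n∸1 = subst (i₀ <_) (cong (_∸ 1) 2+i₀≡n) (ℕP.n<1+n i₀)

    g-c₀ : g c₀ ≡ + 0
    g-c₀ = cong₂ (λ a b → - a +ℤ - b) (e-c₀ (s≤s z≤n) 1<p) (Σℤ-zero (n ∸ 1) vanish)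
      where
        vanish : ∀ j → j < n ∸ 1 → + 2 *ℤ e (j ℕ.+ 2) c₀ ≡ + 0
        vanish j j<n∸1 = cong (+ 2 *ℤ_) (trans (cong (λ x → e x c₀) (j+2≡ j))
                                                (e-c₀ (s≤s z≤n) (ℕP.≤-<-trans (two-below j<n∸1) n<p)))

    g-cₙ : g cₙ ≡ -[1+ 1 ]
    g-cₙ = cong₂ (λ a b → - a +ℤ - b) e₁-cₙ (trans (Σℤ-single (n ∸ 1) i₀ i₀<n∸1 others) last)
      where
        e₁-cₙ : e 1 cₙ ≡ + 0
        e₁-cₙ = trans (e-cₙ (s≤s z≤n) 1≤n) (δ-≢ (ℕP.>⇒≢ (ℕP.<-≤-trans (s≤s (s≤s z≤n)) 3≤n)))
        e-at : ∀ {j} → j < n ∸ 1 → e (j ℕ.+ 2) cₙ ≡ δ n (suc (suc j))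
        e-at {j} j<n∸1 = trans (cong (λ x → e x cₙ) (j+2≡ j)) (e-cₙ (s≤s z≤n) (two-below j<n∸1))
        others : ∀ j → j < n ∸ 1 → j ≢ i₀ → + 2 *ℤ e (j ℕ.+ 2) cₙ ≡ + 0
        others j j<n∸1 j≢i₀ = cong (+ 2 *ℤ_) (trans (e-at j<n∸1)
          (δ-≢ (λ n≡ → j≢i₀ (trans (sym (ℕP.m+n∸n≡m j 2)) (cong (_∸ 2) (trans (j+2≡ j) (sym n≡)))))))
        last : + 2 *ℤ e (i₀ ℕ.+ 2) cₙ ≡ + 2
        last = cong (+ 2 *ℤ_) (trans (e-at i₀<n∸1) (trans (cong (δ n) 2+i₀≡n) (δ-refl n)))

    I-even : ∀ {y} → InI y → ∃ λ d → y cₙ ≡ y c₀ +ℤ d *ℤ -[1+ 1 ]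
    I-even {y} (c , d , c′ , y≈) = d , (begin
      y cₙ                                         ≡⟨ y≈ cₙ ⟩
      (span cₙ +ℤ d *ℤ g cₙ) +ℤ c′                 ≡⟨ cong₂ (λ s t → (s +ℤ d *ℤ t) +ℤ c′) span-cₙ g-cₙ ⟩
      (+ 0 +ℤ d *ℤ -[1+ 1 ]) +ℤ c′                 ≡⟨ regroup d c′ -[1+ 1 ] ⟩
      ((+ 0 +ℤ d *ℤ + 0) +ℤ c′) +ℤ d *ℤ -[1+ 1 ]   ≡⟨ cong (_+ℤ d *ℤ -[1+ 1 ]) y-c₀ ⟨
      y c₀ +ℤ d *ℤ -[1+ 1 ]                        ∎)
      where
        open ≡-Reasoning
        span : Fin p → ℤ
        span k = Σℤ (n ∸ 1) (λ j → c j *ℤ e (suc j) k)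
        span-c₀ : span c₀ ≡ + 0
        span-c₀ = Σℤ-zero (n ∸ 1) (λ j j<n∸1 → trans
          (cong (c j *ℤ_) (e-c₀ (s≤s z≤n) (ℕP.<-trans (two-below j<n∸1) n<p))) (ℤP.*-zeroʳ (c j)))
        span-cₙ : span cₙ ≡ + 0
        span-cₙ = Σℤ-zero (n ∸ 1) (λ j j<n∸1 → trans
          (cong (c j *ℤ_) (trans (e-cₙ (s≤s z≤n) (ℕP.<⇒≤ (two-below j<n∸1))) (δ-≢ (ℕP.>⇒≢ (two-below j<n∸1)))))
          (ℤP.*-zeroʳ (c j)))
        y-c₀ : y c₀ ≡ (+ 0 +ℤ d *ℤ + 0) +ℤ c′
        y-c₀ = trans (y≈ c₀) (cong₂ (λ s t → (s +ℤ d *ℤ t) +ℤ c′) span-c₀ g-c₀)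
        regroup : ∀ d c′ a → (+ 0 +ℤ d *ℤ a) +ℤ c′ ≡ ((+ 0 +ℤ d *ℤ + 0) +ℤ c′) +ℤ d *ℤ a
        regroup = solve-∀

    j₀ : ℕ
    j₀ = suc i₀

    j₀≤n : j₀ ≤ n
    j₀≤n = subst (j₀ ≤_) 2+i₀≡n (ℕP.n≤1+n j₀)

    1≢j₀ : 1 ≢ j₀
    1≢j₀ = ℕP.<⇒≢ (ℕ.s≤s⁻¹ (subst (3 ≤_) (sym 2+i₀≡n) 3≤n))

    p∸[p∸1]≡1 : p ∸ (p ∸ 1) ≡ 1
    p∸[p∸1]≡1 = trans (cong (p ∸_) p∸1≡) p∸[n+n]≡1

    θy-c₀ : (e 1 *ᵉ e j₀) c₀ ≡ + 0
    θy-c₀ = begin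
      (e 1 *ᵉ e j₀) c₀                                ≡⟨ e-*ᵉ (s≤s z≤n) 1<p (e j₀) c₀ ⟩
      e j₀ (shift 1 c₀) +ℤ e j₀ (shift (p ∸ 1) c₀)    ≡⟨ cong₂ _+ℤ_ (e-high (s≤s z≤n) j₀≤n below n<n+n)
                                                                     (e-low (s≤s z≤n) j₀≤n above 1≤n) ⟩
      δ (p ∸ (n ℕ.+ n)) j₀ +ℤ δ 1 j₀                 ≡⟨ cong (λ x → δ x j₀ +ℤ δ 1 j₀) p∸[n+n]≡1 ⟩
      δ 1 j₀ +ℤ δ 1 j₀                                ≡⟨ cong₂ _+ℤ_ (δ-≢ 1≢j₀) (δ-≢ 1≢j₀) ⟩
      + 0                                             ∎
      where
        open ≡-Reasoning
        below : toℕ (shift 1 c₀) ≡ n ℕ.+ n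
        below = trans (shift-< c₀ (subst (_< 1) (sym toℕ-c₀) (s≤s z≤n)) (ℕP.<⇒≤ 1<p))
                      (cong₂ ℕ._+_ toℕ-c₀ p∸1≡)
        above : toℕ (shift (p ∸ 1) c₀) ≡ 1
        above = trans (shift-< c₀ (subst (_< p ∸ 1) (sym toℕ-c₀) (ℕP.m<n⇒0<n∸m 1<p)) (ℕP.m∸n≤m p 1))
                      (cong₂ ℕ._+_ toℕ-c₀ p∸[p∸1]≡1)

    θy-cₙ : (e 1 *ᵉ e j₀) cₙ ≡ + 1
    θy-cₙ = begin
      (e 1 *ᵉ e j₀) cₙ                                ≡⟨ e-*ᵉ (s≤s z≤n) 1<p (e j₀) cₙ ⟩
      e j₀ (shift 1 cₙ) +ℤ e j₀ (shift (p ∸ 1) cₙ)    ≡⟨ cong₂ _+ℤ_ (e-low (s≤s z≤n) j₀≤n below (ℕP.m∸n≤m n 1))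
                                                                     (e-high (s≤s z≤n) j₀≤n above (ℕP.n<1+n n)) ⟩
      δ (n ∸ 1) j₀ +ℤ δ (p ∸ suc n) j₀               ≡⟨ cong₂ (λ a b → δ a j₀ +ℤ δ b j₀) (cong (_∸ 1) (sym 2+i₀≡n)) p∸[1+n]≡n ⟩
      δ j₀ j₀ +ℤ δ n j₀                               ≡⟨ cong₂ _+ℤ_ (δ-refl j₀) (δ-≢ (ℕP.>⇒≢ (subst (j₀ <_) 2+i₀≡n (ℕP.n<1+n j₀)))) ⟩
      + 1                                             ∎
      where
        open ≡-Reasoning
        below : toℕ (shift 1 cₙ) ≡ n ∸ 1
        below = trans (shift-≥ cₙ (subst (1 ≤_) (sym toℕ-cₙ) 1≤n)) (cong (_∸ 1) toℕ-cₙ)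
        above : toℕ (shift (p ∸ 1) cₙ) ≡ suc n
        above = trans (shift-< cₙ (subst₂ _<_ (sym toℕ-cₙ) (sym p∸1≡) n<n+n) (ℕP.m∸n≤m p 1))
                      (trans (cong₂ ℕ._+_ toℕ-cₙ p∸[p∸1]≡1) (ℕP.+-comm n 1))

    not-ideal : ¬ IsIdealOfOK InI
    not-ideal (_ , _ , _ , _ , mul-closed) = θy-odd (I-even (mul-closed (e 1) (e j₀) (e₁∈OK 1<p) (e∈I i₀<n∸1)))
      where
        θy-odd : ¬ (∃ λ d → (e 1 *ᵉ e j₀) cₙ ≡ (e 1 *ᵉ e j₀) c₀ +ℤ d *ℤ -[1+ 1 ])
        θy-odd (d , gap) = 1≢even d (begin
          + 1                                  ≡⟨ θy-cₙ ⟨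
          (e 1 *ᵉ e j₀) cₙ                     ≡⟨ gap ⟩
          (e 1 *ᵉ e j₀) c₀ +ℤ d *ℤ -[1+ 1 ]    ≡⟨ cong (_+ℤ d *ℤ -[1+ 1 ]) θy-c₀ ⟩
          + 0 +ℤ d *ℤ -[1+ 1 ]                 ≡⟨ ℤP.+-identityˡ _ ⟩
          d *ℤ -[1+ 1 ]                        ∎)
          where open ≡-Reasoning

proposition10 : (p : ℕ) → .{{_ : NonZero p}} → Prime p → 7 ≤ p → ¬ Cyclotomic.IsIdealOfOK p (Cyclotomic.InI p)
proposition10 p p-prime 7≤p = OddModulus.not-ideal p≡2n+1 3≤n
  where
    open Cyclotomic p using (n)
    open Coordinates p
    p≡2n+1 : p ≡ suc (n ℕ.+ n)
    p≡2n+1 = prime-shape p-prime 7≤p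
    3≤n : 3 ≤ n
    3≤n = half-≥3 n (ℕ.s≤s⁻¹ (subst (7 ≤_) p≡2n+1 7≤p))
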